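{- $\chi'_{qm\Sigma}(P_3)=2$, and $\chi'_{qm\Sigma}(P_n)=3$ for every $n\ge 4$.
   Context: $P_n$ denotes the path on $n$ vertices. A $k$-edge-coloring of a graph $G$ is any map $c:E(G)\to[k]$ (adjacent edges may receive the same color). It induces $\sigma_c(v)=\sum_{u\in N(v)}c(vu)$. The coloring is neighbor sum distinguishing (NSD) if $\sigma_c(u)\ne\sigma_c(v)$ for every edge $uv$, and quasi-majority (QM) if every vertex $v$ is incident to at most $\lceil d(v)/2\rceil$ edges of each color. $\chi'_{qm\Sigma}(G)$ is the minimum $k$ such that $G$ has a QM and NSD $k$-edge-coloring. -}

module Defs where

open import Data.Nat using (ℕ; zero; suc; _+_; _≤_; _<_; _/_)
open import Data.Nat.Properties using (_≟_)
open import Data.Fin using (Fin; toℕ)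
open import Data.Bool using (Bool; true; false; if_then_else_; _∨_)
open import Data.Product using (Σ; _×_; ∃-syntax)
open import Relation.Binary.PropositionalEquality using (_≡_; _≢_)
open import Relation.Nullary using (¬_)
open import Relation.Nullary.Decidable using (⌊_⌋)

∑ : (n : ℕ) → (Fin n → ℕ) → ℕ
∑ zero    f = 0
∑ (suc n) f = f Fin.zero + ∑ n (λ i → f (Fin.suc i))

record Graph : Set where
  field
    n     : ℕ
    adj   : Fin n → Fin n → Bool
    adj-sym   : ∀ u v → adj u v ≡ adj v u
    adj-irref : ∀ v → adj v v ≡ false
open Graph public

-- an edge-colouring is a symmetric function on ordered pairs of vertices;
-- only its values on edges matter. It is a k-edge-colouring if every edge
-- gets a colour in [k] = {1,…,k}.
IsEdgeColouring : (G : Graph) → ℕ → (Fin (n G) → Fin (n G) → ℕ) → Set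
IsEdgeColouring G k c =
  (∀ u v → c u v ≡ c v u) ×
  (∀ u v → adj G u v ≡ true → (1 ≤ c u v) × (c u v ≤ k))

degree : (G : Graph) → Fin (n G) → ℕ
degree G v = ∑ (n G) (λ u → if adj G v u then 1 else 0)

σ : (G : Graph) → (Fin (n G) → Fin (n G) → ℕ) → Fin (n G) → ℕ
σ G c v = ∑ (n G) (λ u → if adj G v u then c v u else 0)

colourCount : (G : Graph) → (Fin (n G) → Fin (n G) → ℕ) → Fin (n G) → ℕ → ℕ
colourCount G c v j =
  ∑ (n G) (λ u → if adj G v u then (if ⌊ c v u ≟ j ⌋ then 1 else 0) else 0)

ceilHalf : ℕ → ℕ
ceilHalf d = suc d / 2

IsNSD : (G : Graph) → (Fin (n G) → Fin (n G) → ℕ) → Set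
IsNSD G c = ∀ u v → adj G u v ≡ true → σ G c u ≢ σ G c v

IsQM : (G : Graph) → (Fin (n G) → Fin (n G) → ℕ) → Set
IsQM G c = ∀ v j → colourCount G c v j ≤ ceilHalf (degree G v)

HasQMNSD : Graph → ℕ → Set
HasQMNSD G k = ∃[ c ] (IsEdgeColouring G k c × IsQM G c × IsNSD G c)

ChiQMΣ≡ : Graph → ℕ → Set
ChiQMΣ≡ G m = HasQMNSD G m × (∀ k → k < m → ¬ HasQMNSD G k)

pathAdj : (n : ℕ) → Fin n → Fin n → Bool
pathAdj n u v = ⌊ suc (toℕ u) ≟ toℕ v ⌋ ∨ ⌊ suc (toℕ v) ≟ toℕ u ⌋

module _ where
  open import Data.Bool.Properties using (∨-comm)
  open import Data.Nat.Properties using (n<1+n; <-irrefl)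
  open import Relation.Nullary using (yes; no)
  open import Data.Empty using (⊥-elim)
  open import Relation.Binary.PropositionalEquality using (sym; refl)

  pathAdj-sym : ∀ n u v → pathAdj n u v ≡ pathAdj n v u
  pathAdj-sym n u v = ∨-comm (⌊ suc (toℕ u) ≟ toℕ v ⌋) _

  pathAdj-irref : ∀ n v → pathAdj n v v ≡ false
  pathAdj-irref n v with suc (toℕ v) ≟ toℕ v
  ... | yes e = ⊥-elim (<-irrefl (sym e) (n<1+n (toℕ v)))
  ... | no _  = refl

P : ℕ → Graph
P m = record { n = m ; adj = pathAdj m ; adj-sym = pathAdj-sym m ; adj-irref = pathAdj-irref m }

{-# OPTIONS --safe #-}
-- A vertex of degree 2 may carry at most ⌈2/2⌉ = 1 edge of each colour, so on a path
-- quasi-majority says exactly that the two edges at every interior vertex have distinct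
-- colours. With colours {1, 2} every interior vertex then has σ = 1 + 2 = 3, so the adjacent
-- interior vertices 1 and 2 of P_n (n ≥ 4) clash; with a single colour already P₃ fails.
-- Conversely, colour the edge {i, i+1} by 1, 2, 3 periodically in i. The sums at the two ends
-- of an edge share its colour, so they differ iff the colours of the edges just outside it
-- differ: these are edges i−1 and i+1, distinct by periodicity, or one of them is missing and
-- a positive colour is compared with 0 (both are missing only on P₂). On P₃ only 1, 2 occur.
module Submission where

open import Defs
open import Data.Nat using (ℕ; _≤_)
open import Data.Product using (_×_)

open import Level using (0ℓ)
open import Algebra.Properties.CommutativeSemigroup using (interchange)
open import Data.Nat using (zero; suc; _+_; _<_; _⊓_; z≤n; s≤s; s≤s⁻¹; _<?_)
open import Data.Nat.Properties
  using (_≟_; ≤-refl; ≤-trans; ≤-reflexive; ≤-antisym; +-mono-≤; +-comm; +-identityʳ;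
         +-cancelˡ-≡; +-commutativeSemigroup; suc-injective; 0≢1+n; n≤1+n; n<1+n; m<n⇒m<1+n;
         <⇒≢; <⇒≱; ≮⇒≥; n≮n; m<n⇒n≢0; m≤n⇒m⊓n≡m; ⊓-comm; module ≤-Reasoning)
open import Data.Fin using (Fin; zero; suc; toℕ; inject₁; fromℕ<)
open import Data.Fin.Patterns using (0F; 1F; 2F; 3F)
open import Data.Fin.Properties using (toℕ-injective; toℕ-inject₁; toℕ-fromℕ<; toℕ<n)
  renaming (suc-injective to Fin-suc-injective; 0≢1+n to Fin-0≢1+n)
open import Data.Bool using (true; false; if_then_else_; _∨_)
open import Data.Product using (_,_; map₂)
open import Function using (_∘_; flip)
open import Relation.Unary using (Pred; Decidable)
open import Relation.Nullary using (¬_; yes; no; contradiction)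
open import Relation.Nullary.Decidable using (⌊_⌋)
open import Relation.Binary.PropositionalEquality
  using (_≡_; _≢_; refl; sym; trans; cong; cong₂; subst; module ≡-Reasoning)

variable
  m k : ℕ

∑-cong : ∀ k {f g : Fin k → ℕ} → (∀ i → f i ≡ g i) → ∑ k f ≡ ∑ k g
∑-cong zero    _   = refl
∑-cong (suc k) f≗g = cong₂ _+_ (f≗g zero) (∑-cong k (f≗g ∘ suc))

∑-mono-≤ : ∀ k {f g : Fin k → ℕ} → (∀ i → f i ≤ g i) → ∑ k f ≤ ∑ k g
∑-mono-≤ zero    _   = z≤n
∑-mono-≤ (suc k) f≤g = +-mono-≤ (f≤g zero) (∑-mono-≤ k (f≤g ∘ suc))

∑-distrib-+ : ∀ k (f g : Fin k → ℕ) → ∑ k (λ i → f i + g i) ≡ ∑ k f + ∑ k g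
∑-distrib-+ zero    f g = refl
∑-distrib-+ (suc k) f g =
  trans (cong (f zero + g zero +_) (∑-distrib-+ k (f ∘ suc) (g ∘ suc)))
        (interchange +-commutativeSemigroup (f zero) (g zero) _ _)

∑-if-none : ∀ k {Q : Pred (Fin k) 0ℓ} (Q? : Decidable Q) (f : Fin k → ℕ) →
            (∀ i → ¬ Q i) → ∑ k (λ i → if ⌊ Q? i ⌋ then f i else 0) ≡ 0
∑-if-none zero    Q? f ¬Q = refl
∑-if-none (suc k) Q? f ¬Q with Q? zero
... | yes Q0 = contradiction Q0 (¬Q zero)
... | no  _  = ∑-if-none k (Q? ∘ suc) (f ∘ suc) (¬Q ∘ suc)

∑-if-unique : ∀ k {Q : Pred (Fin k) 0ℓ} (Q? : Decidable Q) (f : Fin k → ℕ) {w : Fin k} →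
              Q w → (∀ i → Q i → i ≡ w) → ∑ k (λ i → if ⌊ Q? i ⌋ then f i else 0) ≡ f w
∑-if-unique (suc k) Q? f {zero} Qw unique with Q? zero
... | yes _  = trans (cong (f zero +_) (∑-if-none k (Q? ∘ suc) (f ∘ suc) (λ i → Fin-0≢1+n ∘ sym ∘ unique (suc i))))
                     (+-identityʳ (f zero))
... | no ¬Q0 = contradiction Qw ¬Q0
∑-if-unique (suc k) Q? f {suc w} Qw unique with Q? zero
... | yes Q0 = contradiction (unique zero Q0) Fin-0≢1+n
... | no  _  = ∑-if-unique k (Q? ∘ suc) (f ∘ suc) Qw (λ i → Fin-suc-injective ∘ unique (suc i))

_⋖_ : Fin m → Fin m → Set
u ⋖ v = suc (toℕ u) ≡ toℕ v

⋖-asym : ∀ {u v : Fin m} → u ⋖ v → ¬ v ⋖ u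
⋖-asym {u = u} u⋖v v⋖u = <⇒≢ (m<n⇒m<1+n (n<1+n (toℕ u))) (sym (trans (cong suc u⋖v) v⋖u))

⋖⇒pathAdj : ∀ {u v : Fin m} → u ⋖ v → pathAdj m u v ≡ true
⋖⇒pathAdj {u = u} {v} u⋖v with suc (toℕ u) ≟ toℕ v
... | yes _     = refl
... | no  u⋖̸v  = contradiction u⋖v u⋖̸v

pathAdj-elim : {R : Fin m → Fin m → Set} → (∀ {u v} → R u v → R v u) → (∀ {u v} → u ⋖ v → R u v) →
               ∀ u v → pathAdj m u v ≡ true → R u v
pathAdj-elim R-sym R-⋖ u v uv with suc (toℕ u) ≟ toℕ v | suc (toℕ v) ≟ toℕ u
... | yes u⋖v | _       = R-⋖ u⋖v
... | no  _   | yes v⋖u = R-sym (R-⋖ v⋖u)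
... | no  _   | no  _   with () ← uv

data PrevView {m} (v : Fin m) : Set where
  first : toℕ v ≡ 0 → PrevView v
  prev  : ∀ w → w ⋖ v → PrevView v

prevView : (v : Fin m) → PrevView v
prevView zero    = first refl
prevView (suc v) = prev (inject₁ v) (cong suc (toℕ-inject₁ v))

data NextView {m} (v : Fin m) : Set where
  last : m ≤ suc (toℕ v) → NextView v
  next : ∀ w → v ⋖ w → NextView v

nextView : (v : Fin m) → NextView v
nextView {m} v with suc (toℕ v) <? m
... | yes 1+v<m = next (fromℕ< 1+v<m) (sym (toℕ-fromℕ< 1+v<m))
... | no  1+v≮m = last (≮⇒≥ 1+v≮m)

∑→ ∑← : ∀ m → Fin m → (Fin m → ℕ) → ℕ
∑→ m v f = ∑ m (λ u → if ⌊ suc (toℕ v) ≟ toℕ u ⌋ then f u else 0)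
∑← m v f = ∑ m (λ u → if ⌊ suc (toℕ u) ≟ toℕ v ⌋ then f u else 0)

∑-pathAdj : ∀ (v : Fin m) f → ∑ m (λ u → if pathAdj m v u then f u else 0) ≡ ∑→ m v f + ∑← m v f
∑-pathAdj {m} v f = trans (∑-cong m split) (∑-distrib-+ m _ _)
  where
  split : ∀ u → (if ⌊ suc (toℕ v) ≟ toℕ u ⌋ ∨ ⌊ suc (toℕ u) ≟ toℕ v ⌋ then f u else 0) ≡
                (if ⌊ suc (toℕ v) ≟ toℕ u ⌋ then f u else 0) + (if ⌊ suc (toℕ u) ≟ toℕ v ⌋ then f u else 0)
  split u with suc (toℕ v) ≟ toℕ u | suc (toℕ u) ≟ toℕ v
  ... | yes v⋖u | yes u⋖v = contradiction u⋖v (⋖-asym v⋖u)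
  ... | yes _   | no  _   = sym (+-identityʳ (f u))
  ... | no  _   | _       = refl

degree-P : ∀ (v : Fin m) → degree (P m) v ≡ ∑→ m v (λ _ → 1) + ∑← m v (λ _ → 1)
degree-P v = ∑-pathAdj v (λ _ → 1)

module _ {v : Fin m} {f : Fin m → ℕ} where

  ∑→-next : ∀ {w} → v ⋖ w → ∑→ m v f ≡ f w
  ∑→-next v⋖w = ∑-if-unique m (λ u → suc (toℕ v) ≟ toℕ u) f v⋖w
    (λ u v⋖u → toℕ-injective (trans (sym v⋖u) v⋖w))

  ∑→-last : m ≤ suc (toℕ v) → ∑→ m v f ≡ 0
  ∑→-last m≤1+v = ∑-if-none m (λ u → suc (toℕ v) ≟ toℕ u) f
    (λ u v⋖u → <⇒≱ (toℕ<n u) (≤-trans m≤1+v (≤-reflexive v⋖u)))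

  ∑←-prev : ∀ {w} → w ⋖ v → ∑← m v f ≡ f w
  ∑←-prev w⋖v = ∑-if-unique m (λ u → suc (toℕ u) ≟ toℕ v) f w⋖v
    (λ u u⋖v → toℕ-injective (suc-injective (trans u⋖v (sym w⋖v))))

  ∑←-first : toℕ v ≡ 0 → ∑← m v f ≡ 0
  ∑←-first v≡0 = ∑-if-none m (λ u → suc (toℕ u) ≟ toℕ v) f
    (λ u u⋖v → 0≢1+n (trans (sym v≡0) (sym u⋖v)))

  ∑-pathAdj-interior : ∀ {w w′} → w ⋖ v → v ⋖ w′ → ∑ m (λ u → if pathAdj m v u then f u else 0) ≡ f w′ + f w
  ∑-pathAdj-interior w⋖v v⋖w′ = trans (∑-pathAdj v f) (cong₂ _+_ (∑→-next v⋖w′) (∑←-prev w⋖v))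

δ : ℕ → ℕ → ℕ
δ i j = if ⌊ i ≟ j ⌋ then 1 else 0

δ-refl : ∀ i → δ i i ≡ 1
δ-refl i with i ≟ i
... | yes _   = refl
... | no  i≢i = contradiction refl i≢i

δ≤1 : ∀ i j → δ i j ≤ 1
δ≤1 i j with i ≟ j
... | yes _ = ≤-refl
... | no  _ = z≤n

δ+δ≤1 : ∀ {i i′} j → i ≢ i′ → δ i j + δ i′ j ≤ 1
δ+δ≤1 {i} {i′} j i≢i′ with i ≟ j | i′ ≟ j
... | yes refl | yes refl = contradiction refl i≢i′
... | yes _    | no  _    = ≤-refl
... | no  _    | yes _    = ≤-refl
... | no  _    | no  _    = z≤n

colourCount≤degree : ∀ G c v j → colourCount G c v j ≤ degree G v
colourCount≤degree G c v j = ∑-mono-≤ (n G) pointwise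
  where
  pointwise : ∀ u → (if adj G v u then δ (c v u) j else 0) ≤ (if adj G v u then 1 else 0)
  pointwise u with adj G v u
  ... | true  = δ≤1 (c v u) j
  ... | false = z≤n

d≤ceilHalf[d] : ∀ {d} → d ≤ 1 → d ≤ ceilHalf d
d≤ceilHalf[d] z≤n       = z≤n
d≤ceilHalf[d] (s≤s z≤n) = ≤-refl

degree≤1⇒colourCount≤ceilHalf : ∀ G c v j → degree G v ≤ 1 → colourCount G c v j ≤ ceilHalf (degree G v)
degree≤1⇒colourCount≤ceilHalf G c v j d≤1 = ≤-trans (colourCount≤degree G c v j) (d≤ceilHalf[d] d≤1)

distinct-in-[1,2]⇒+≡3 : ∀ {x y} → 1 ≤ x × x ≤ 2 → 1 ≤ y × y ≤ 2 → x ≢ y → x + y ≡ 3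
distinct-in-[1,2]⇒+≡3 (s≤s z≤n , s≤s z≤n)       (s≤s z≤n , s≤s z≤n)       1≢1 = contradiction refl 1≢1
distinct-in-[1,2]⇒+≡3 (s≤s z≤n , s≤s z≤n)       (s≤s z≤n , s≤s (s≤s z≤n)) _   = refl
distinct-in-[1,2]⇒+≡3 (s≤s z≤n , s≤s (s≤s z≤n)) (s≤s z≤n , s≤s z≤n)       _   = refl
distinct-in-[1,2]⇒+≡3 (s≤s z≤n , s≤s (s≤s z≤n)) (s≤s z≤n , s≤s (s≤s z≤n)) 2≢2 = contradiction refl 2≢2

module _ {c : Fin m → Fin m → ℕ} where
  open ≤-Reasoning

  IsQM⇒interior-≢ : IsQM (P m) c → ∀ {w v w′} → w ⋖ v → v ⋖ w′ → c v w′ ≢ c v w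
  IsQM⇒interior-≢ qm {w} {v} {w′} w⋖v v⋖w′ c≡ = n≮n 1 (begin
    2                                       ≡⟨ cong₂ _+_ (trans (cong (flip δ (c v w)) c≡) (δ-refl (c v w))) (δ-refl (c v w)) ⟨
    δ (c v w′) (c v w) + δ (c v w) (c v w)  ≡⟨ ∑-pathAdj-interior w⋖v v⋖w′ ⟨
    colourCount (P m) c v (c v w)           ≤⟨ qm v (c v w) ⟩
    ceilHalf (degree (P m) v)               ≡⟨ cong ceilHalf (∑-pathAdj-interior w⋖v v⋖w′) ⟩
    1                                       ∎)

  interior-≢⇒IsQM : (∀ {w v w′} → w ⋖ v → v ⋖ w′ → c v w′ ≢ c v w) → IsQM (P m) c
  interior-≢⇒IsQM distinct v j with prevView v | nextView v
  ... | prev w w⋖v | next w′ v⋖w′ = begin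
    colourCount (P m) c v j     ≡⟨ ∑-pathAdj-interior w⋖v v⋖w′ ⟩
    δ (c v w′) j + δ (c v w) j  ≤⟨ δ+δ≤1 j (distinct w⋖v v⋖w′) ⟩
    1                           ≡⟨ cong ceilHalf (∑-pathAdj-interior w⋖v v⋖w′) ⟨
    ceilHalf (degree (P m) v)   ∎
  ... | first v≡0  | next w′ v⋖w′ = degree≤1⇒colourCount≤ceilHalf (P m) c v j
    (≤-reflexive (trans (degree-P v) (cong₂ _+_ (∑→-next v⋖w′) (∑←-first v≡0))))
  ... | first v≡0  | last m≤1+v   = degree≤1⇒colourCount≤ceilHalf (P m) c v j
    (≤-trans (≤-reflexive (trans (degree-P v) (cong₂ _+_ (∑→-last m≤1+v) (∑←-first v≡0)))) z≤n)
  ... | prev w w⋖v | last m≤1+v   = degree≤1⇒colourCount≤ceilHalf (P m) c v j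
    (≤-reflexive (trans (degree-P v) (cong₂ _+_ (∑→-last m≤1+v) (∑←-prev w⋖v))))

  σ-edge-cancel : (∀ u v → c u v ≡ c v u) → ∀ {a b} → a ⋖ b → σ (P m) c a ≡ σ (P m) c b →
                  ∑← m a (c a) ≡ ∑→ m b (c b)
  σ-edge-cancel c-sym {a} {b} a⋖b σa≡σb = +-cancelˡ-≡ (c a b) _ _ (begin-equality
    c a b + ∑← m a (c a)         ≡⟨ cong (_+ ∑← m a (c a)) (∑→-next a⋖b) ⟨
    ∑→ m a (c a) + ∑← m a (c a)  ≡⟨ ∑-pathAdj a (c a) ⟨
    σ (P m) c a                  ≡⟨ σa≡σb ⟩
    σ (P m) c b                  ≡⟨ ∑-pathAdj b (c b) ⟩
    ∑→ m b (c b) + ∑← m b (c b)  ≡⟨ cong (∑→ m b (c b) +_) (∑←-prev a⋖b) ⟩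
    ∑→ m b (c b) + c b a         ≡⟨ +-comm _ (c b a) ⟩
    c b a + ∑→ m b (c b)         ≡⟨ cong (_+ ∑→ m b (c b)) (c-sym b a) ⟩
    c a b + ∑→ m b (c b)         ∎)

  interior-σ≡3 : IsEdgeColouring (P m) 2 c → IsQM (P m) c → ∀ {w v w′} → w ⋖ v → v ⋖ w′ → σ (P m) c v ≡ 3
  interior-σ≡3 (_ , c-range) qm {w} {v} {w′} w⋖v v⋖w′ =
    trans (∑-pathAdj-interior w⋖v v⋖w′)
          (distinct-in-[1,2]⇒+≡3 (c-range v w′ (⋖⇒pathAdj v⋖w′))
                                 (c-range v w (trans (pathAdj-sym m v w) (⋖⇒pathAdj w⋖v)))
                                 (IsQM⇒interior-≢ qm w⋖v v⋖w′))

edgeColour : ℕ → ℕ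
edgeColour 0                   = 1
edgeColour 1                   = 2
edgeColour 2                   = 3
edgeColour (suc (suc (suc i))) = edgeColour i

1≤edgeColour : ∀ i → 1 ≤ edgeColour i
1≤edgeColour 0                   = s≤s z≤n
1≤edgeColour 1                   = s≤s z≤n
1≤edgeColour 2                   = s≤s z≤n
1≤edgeColour (suc (suc (suc i))) = 1≤edgeColour i

edgeColour≤3 : ∀ i → edgeColour i ≤ 3
edgeColour≤3 0                   = s≤s z≤n
edgeColour≤3 1                   = s≤s (s≤s z≤n)
edgeColour≤3 2                   = ≤-refl
edgeColour≤3 (suc (suc (suc i))) = edgeColour≤3 i

edgeColour≤1+i : ∀ i → edgeColour i ≤ suc i
edgeColour≤1+i 0                   = ≤-refl
edgeColour≤1+i 1                   = ≤-refl
edgeColour≤1+i 2                   = ≤-refl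
edgeColour≤1+i (suc (suc (suc i))) = ≤-trans (edgeColour≤3 i) (s≤s (s≤s (s≤s z≤n)))

edgeColour[1+i]≢edgeColour[i] : ∀ i → edgeColour (suc i) ≢ edgeColour i
edgeColour[1+i]≢edgeColour[i] 0                   = λ ()
edgeColour[1+i]≢edgeColour[i] 1                   = λ ()
edgeColour[1+i]≢edgeColour[i] 2                   = λ ()
edgeColour[1+i]≢edgeColour[i] (suc (suc (suc i))) = edgeColour[1+i]≢edgeColour[i] i

edgeColour[2+i]≢edgeColour[i] : ∀ i → edgeColour (suc (suc i)) ≢ edgeColour i
edgeColour[2+i]≢edgeColour[i] 0                   = λ ()
edgeColour[2+i]≢edgeColour[i] 1                   = λ ()
edgeColour[2+i]≢edgeColour[i] 2                   = λ ()
edgeColour[2+i]≢edgeColour[i] (suc (suc (suc i))) = edgeColour[2+i]≢edgeColour[i] i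

pathColouring : Fin m → Fin m → ℕ
pathColouring u v = edgeColour (toℕ u ⊓ toℕ v)

pathColouring-sym : ∀ (u v : Fin m) → pathColouring u v ≡ pathColouring v u
pathColouring-sym u v = cong edgeColour (⊓-comm (toℕ u) (toℕ v))

1≤pathColouring : ∀ (u v : Fin m) → 1 ≤ pathColouring u v
1≤pathColouring u v = 1≤edgeColour (toℕ u ⊓ toℕ v)

pathColouring≤3 : ∀ (u v : Fin m) → pathColouring u v ≤ 3
pathColouring≤3 u v = edgeColour≤3 (toℕ u ⊓ toℕ v)

pathColouring-⋖ : ∀ {u v : Fin m} → u ⋖ v → pathColouring u v ≡ edgeColour (toℕ u)
pathColouring-⋖ u⋖v = cong edgeColour (m≤n⇒m⊓n≡m (≤-trans (n≤1+n _) (≤-reflexive u⋖v)))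

pathColouring-⋗ : ∀ {u v : Fin m} → u ⋖ v → pathColouring v u ≡ edgeColour (toℕ u)
pathColouring-⋗ {u = u} {v} u⋖v = trans (pathColouring-sym v u) (pathColouring-⋖ u⋖v)

pathColouring-IsQM : IsQM (P m) pathColouring
pathColouring-IsQM = interior-≢⇒IsQM distinct
  where
  distinct : ∀ {w v w′} → w ⋖ v → v ⋖ w′ → pathColouring v w′ ≢ pathColouring v w
  distinct {w} {v} {w′} w⋖v v⋖w′ c≡ = edgeColour[1+i]≢edgeColour[i] (toℕ w) (begin
    edgeColour (suc (toℕ w))  ≡⟨ cong edgeColour w⋖v ⟩
    edgeColour (toℕ v)        ≡⟨ pathColouring-⋖ v⋖w′ ⟨
    pathColouring v w′        ≡⟨ c≡ ⟩
    pathColouring v w         ≡⟨ pathColouring-⋗ w⋖v ⟩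
    edgeColour (toℕ w)        ∎)
    where open ≡-Reasoning

pathColouring-IsNSD : 3 ≤ m → IsNSD (P m) pathColouring
pathColouring-IsNSD {m} 3≤m = pathAdj-elim (_∘ sym) (λ a⋖b → outer-≢ a⋖b ∘ σ-edge-cancel pathColouring-sym a⋖b)
  where
  outer-≢ : ∀ {a b : Fin m} → a ⋖ b → ∑← m a (pathColouring a) ≢ ∑→ m b (pathColouring b)
  outer-≢ {a} {b} a⋖b with prevView a | nextView b
  ... | first a≡0  | last m≤1+b =
    λ _ → n≮n 2 (≤-trans 3≤m (≤-trans m≤1+b (≤-reflexive (cong suc (trans (sym a⋖b) (cong suc a≡0))))))
  ... | first a≡0  | next w′ b⋖w′
    rewrite ∑←-first {f = pathColouring a} a≡0 | ∑→-next {f = pathColouring b} b⋖w′ =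
    m<n⇒n≢0 (1≤pathColouring b w′) ∘ sym
  ... | prev w w⋖a | last m≤1+b
    rewrite ∑←-prev {f = pathColouring a} w⋖a | ∑→-last {f = pathColouring b} m≤1+b =
    m<n⇒n≢0 (1≤pathColouring a w)
  ... | prev w w⋖a | next w′ b⋖w′
    rewrite ∑←-prev {f = pathColouring a} w⋖a | ∑→-next {f = pathColouring b} b⋖w′
          | pathColouring-⋗ w⋖a | pathColouring-⋖ b⋖w′ =
    λ c≡ → edgeColour[2+i]≢edgeColour[i] (toℕ w) (trans (cong edgeColour (trans (cong suc w⋖a) a⋖b)) (sym c≡))

pathColouring<m : ∀ (u v : Fin m) → pathAdj m u v ≡ true → pathColouring u v < m
pathColouring<m {m} = pathAdj-elim (λ {u} {v} → subst (_< m) (pathColouring-sym u v)) bound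
  where
  open ≤-Reasoning
  bound : ∀ {u v : Fin m} → u ⋖ v → pathColouring u v < m
  bound {u} {v} u⋖v = begin-strict
    pathColouring u v   ≡⟨ pathColouring-⋖ u⋖v ⟩
    edgeColour (toℕ u)  ≤⟨ edgeColour≤1+i (toℕ u) ⟩
    suc (toℕ u)         ≡⟨ u⋖v ⟩
    toℕ v               <⟨ toℕ<n v ⟩
    m                   ∎

pathColouring-HasQMNSD : 3 ≤ m → (∀ (u v : Fin m) → pathAdj m u v ≡ true → pathColouring u v ≤ k) →
                         HasQMNSD (P m) k
pathColouring-HasQMNSD 3≤m ≤k =
  pathColouring , (pathColouring-sym , λ u v uv → 1≤pathColouring u v , ≤k u v uv) ,
  pathColouring-IsQM , pathColouring-IsNSD 3≤m

P₃-no-QMNSD-1-colouring : ¬ HasQMNSD (P 3) 1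
P₃-no-QMNSD-1-colouring (c , (_ , c-range) , qm , _) =
  IsQM⇒interior-≢ {c = c} qm {0F} {1F} {2F} refl refl
    (trans (only-1 (c-range 1F 2F refl)) (sym (only-1 (c-range 1F 0F refl))))
  where
  only-1 : ∀ {x} → 1 ≤ x × x ≤ 1 → x ≡ 1
  only-1 (1≤x , x≤1) = ≤-antisym x≤1 1≤x

P≥4-no-QMNSD-2-colouring : 4 ≤ m → ¬ HasQMNSD (P m) 2
P≥4-no-QMNSD-2-colouring (s≤s (s≤s (s≤s (s≤s _)))) (c , colouring , qm , nsd) =
  nsd 1F 2F refl (trans (interior-σ≡3 colouring qm {0F} {1F} {2F} refl refl)
                        (sym (interior-σ≡3 colouring qm {1F} {2F} {3F} refl refl)))

HasQMNSD-mono : ∀ G {k k′} → k ≤ k′ → HasQMNSD G k → HasQMNSD G k′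
HasQMNSD-mono G k≤k′ (c , (c-sym , c-range) , qm , nsd) =
  c , (c-sym , λ u v uv → map₂ (flip ≤-trans k≤k′) (c-range u v uv)) , qm , nsd

ChiQMΣ≡-intro : ∀ G {k} → HasQMNSD G (suc k) → ¬ HasQMNSD G k → ChiQMΣ≡ G (suc k)
ChiQMΣ≡-intro G has ¬has = has , λ j j<1+k → ¬has ∘ HasQMNSD-mono G (s≤s⁻¹ j<1+k)

mainTheorem13 : ChiQMΣ≡ (P 3) 2 × (∀ m → 4 ≤ m → ChiQMΣ≡ (P m) 3)
mainTheorem13 =
  ChiQMΣ≡-intro (P 3)
    (pathColouring-HasQMNSD ≤-refl (λ u v → s≤s⁻¹ ∘ pathColouring<m u v))
    P₃-no-QMNSD-1-colouring ,
  λ m 4≤m → ChiQMΣ≡-intro (P m)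
    (pathColouring-HasQMNSD (≤-trans (n≤1+n 3) 4≤m) (λ u v _ → pathColouring≤3 u v))
    (P≥4-no-QMNSD-2-colouring 4≤m)
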